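{- For every fixed $p\ge 4$, the worst-case running time of the WFG algorithm (described in the context) on stable sets of $n$ points in $\mathbb{R}^p$ is $\Omega(n^{\lfloor p/2\rfloor}\log n)$.
   Context: Throughout, minimization is assumed and $z^{\mathrm r}$ is the reference point. For $z,z'\in\mathbb{R}^p$, $\mathrm{pmax}(z,z')=(\max\{z_j,z'_j\})_j$. A set is stable if no point in it dominates another, where $z\le z'$ means $z_j\le z'_j$ for all $j$ and $z\ne z'$. For a finite set $M$, $M_{\mathrm{nd}}$ is its set of nondominated points. The WFG algorithm computes the hypervolume recursively: - $\mathrm{WFG}(\emptyset)=0$. - $\mathrm{WFG}(\{\bar z\})=\prod_j(z^{\mathrm r}_j-\bar z_j)$. - $\mathrm{WFG}(N\cup\{\bar z\})=\mathrm{WFG}(N)+\mathrm{WFG}(\{\bar z\})-\mathrm{WFG}(N')$, where $N'=\{\mathrm{pmax}(\bar z,z):z\in N\}_{\mathrm{nd}}$. In dimension $d$, the points are processed in non-decreasing order of component $d$ (the last component, which is imposed at each recursion level). All points of $N'$ then share coordinate $d$ equal to $\bar z_d$, and $\mathrm{WFG}(N')$ is computed as $(z^{\mathrm r}_d-\bar z_d)$ times the hypervolume of the $(d-1)$-dimensional projection of $N'$. That projection is sorted by its last component $d-1$ and solved recursively. Two-dimensional subproblems are solved by a sort-and-sweep taking $\Theta(m\log m)$ time on $m$ points. -}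

module Defs where

open import Data.Nat using (ℕ; zero; suc; _+_; _*_; _≤_; _≤?_; _⊔_)
open import Data.Nat.Logarithm using (⌊log₂_⌋)
open import Data.Nat.Properties using () renaming (_≟_ to _≟ℕ_)
open import Data.List using (List; []; _∷_; _++_; [_]; length; map; filter; deduplicate)
open import Data.List.Relation.Unary.Any using (Any; any?)
open import Data.Vec using (Vec; last; init; zipWith)
open import Data.Vec.Properties using (≡-dec)
open import Data.Vec.Relation.Binary.Pointwise.Inductive using (Pointwise)
  renaming (decidable to pw-dec)
open import Data.Product using (_×_)
open import Relation.Nullary using (¬_; Dec; yes; no; does; _×-dec_; ¬?)
open import Relation.Binary.PropositionalEquality using (_≡_; _≢_)
open import Data.Bool using (if_then_else_)

-- Points of R^p are represented by vectors of naturals.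
Point : ℕ → Set
Point p = Vec ℕ p

pmax : ∀ {p} → Point p → Point p → Point p
pmax = zipWith _⊔_

-- z dominates z' (minimization):  z ≤ z' componentwise and z ≠ z'.
_≺_ : ∀ {p} → Point p → Point p → Set
z ≺ z' = Pointwise _≤_ z z' × z ≢ z'

_≺?_ : ∀ {p} (z z' : Point p) → Dec (z ≺ z')
z ≺? z' = pw-dec _≤?_ z z' ×-dec ¬? (≡-dec _≟ℕ_ z z')

Stable : ∀ {p} → List (Point p) → Set
Stable S = ∀ {z z'} → Any (z ≡_) S → Any (z' ≡_) S → ¬ (z ≺ z')

-- M_nd : the set of nondominated points of the finite set M
-- (duplicates removed, since M is a set).
nd : ∀ {p} → List (Point p) → List (Point p)
nd M = filter (λ z → ¬? (any? (λ w → w ≺? z) M')) M'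
  where M' = deduplicate (≡-dec _≟ℕ_) M

insertLast : ∀ {p} → Point (suc p) → List (Point (suc p)) → List (Point (suc p))
insertLast z [] = z ∷ []
insertLast z (w ∷ ws) =
  if does (last z ≤? last w) then z ∷ w ∷ ws else w ∷ insertLast z ws

sortLast : ∀ {p} → List (Point (suc p)) → List (Point (suc p))
sortLast [] = []
sortLast (z ∷ zs) = insertLast z (sortLast zs)

-- Dimension 2: sort-and-sweep, cost m * (⌊log₂ m⌋ + 1) on m points.
-- Dimension ≥ 3: points processed in non-decreasing order of the last
-- component; processing z̄ after the points N costs one unit plus the cost
-- of WFG on the (d-1)-dimensional projection of N' = {pmax(z̄,z) : z ∈ N}_nd.
mutual
  wfgTime : (d : ℕ) → List (Point (2 + d)) → ℕ
  wfgTime zero L = length L * (⌊log₂ length L ⌋ + 1)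
  wfgTime (suc d) L = sweep d [] (sortLast L)

  sweep : (d : ℕ) → List (Point (3 + d)) → List (Point (3 + d)) → ℕ
  sweep d N [] = 0
  sweep d N (z ∷ zs) =
    1 + wfgTime d (map init (nd (map (pmax z) N))) + sweep d (N ++ [ z ]) zs

-- Running time of WFG in dimension p (only meaningful for p ≥ 2).
WFGtime : (p : ℕ) → List (Point p) → ℕ
WFGtime (suc (suc d)) S = wfgTime d S
WFGtime _ _ = 0

module Submission where

-- All points used lie strictly above (1,…,1). A staircase of b points in the plane
-- costs b (⌊log₂ b⌋ + 1). To lift a set S by two dimensions, put S on the floor
-- S × (1,1) and add a ladder of t + 1 points (1,…,1,β,μ) with β decreasing and μ
-- increasing. WFG sweeps the floor first and then the rungs; when the rung at height α
-- is processed, the pmax of the earlier points with it projects to S × α capped by the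
-- single point (1,…,1,α+1), and processing that cap alone already costs WFG(S).
-- So every lift multiplies the running time by t, and m lifts of a planar staircase
-- give b + m (t + 1) points in dimension 2m + 2 at cost t^m b ⌊log₂ b⌋; choosing
-- b and t proportional to n gives Ω(n^(m+1) log n). Odd dimensions cap the
-- even-dimensional instance by one more point.

open import Defs
open import Data.Bool using (true)
open import Data.Empty using (⊥)
open import Data.List using (List; []; _∷_; _++_; [_]; length; map; filter; deduplicate; downFrom)
open import Data.List.Membership.Propositional using (_∈_)
open import Data.List.Membership.Propositional.Properties using (∈-map⁺; ∈-map⁻; ∈-++⁺ʳ; ∈-++⁻; ∈-downFrom⁺)
open import Data.List.Properties
  using (map-∘; map-++; ++-assoc; ++-identityʳ; filter-all; filter-accept; filter-reject; filter-++; length-++; length-map)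
open import Data.List.Relation.Unary.All as All using (All; []; _∷_)
import Data.List.Relation.Unary.All.Properties as All
open import Data.List.Relation.Unary.AllPairs as AllPairs using (AllPairs; []; _∷_)
import Data.List.Relation.Unary.AllPairs.Properties as AllPairs
open import Data.List.Relation.Unary.Any using (Any; here; there; any?)
open import Data.List.Relation.Unary.Unique.Propositional using (Unique)
import Data.List.Relation.Unary.Unique.Propositional.Properties as Unique
open import Data.Nat using (ℕ; zero; suc; _+_; _*_; _^_; _≤_; _<_; _/_; _%_; _⊔_; _≤ᵇ_; z≤n; s≤s; NonZero)
open import Data.Nat.DivMod using (m≡m%n+[m/n]*n; m%n<n; m*n/n≡m; /-monoˡ-≤)
open import Data.Nat.Logarithm using (⌊log₂_⌋; ⌊log₂[2*b]⌋≡1+⌊log₂b⌋; ⌊log₂⌋-mono-≤)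
open import Data.Nat.Properties
open import Data.Nat.Tactic.RingSolver using (solve-∀)
open import Data.Product using (Σ; ∃; ∃₂; _×_; _,_; proj₁; proj₂)
open import Data.Sum using (_⊎_; inj₁; inj₂)
open import Data.Vec using ([]; _∷_; _∷ʳ_; replicate; init; last)
open import Data.Vec.Properties using (≡-dec; ∷ʳ-injective; init-∷ʳ; last-∷ʳ)
open import Data.Vec.Relation.Binary.Pointwise.Inductive using (Pointwise; []; _∷_)
open import Function using (_∘_)
open import Relation.Binary.PropositionalEquality hiding ([_])
open import Relation.Nullary using (¬_; Dec; ¬?)

infix 4 _≼_

_≼_ : ∀ {q} → Point q → Point q → Set
_≼_ = Pointwise _≤_

≼-refl : ∀ {q} (x : Point q) → x ≼ x
≼-refl [] = []
≼-refl (a ∷ x) = ≤-refl ∷ ≼-refl x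

≼-antisym : ∀ {q} {x y : Point q} → x ≼ y → y ≼ x → x ≡ y
≼-antisym [] [] = refl
≼-antisym (a≤b ∷ x≼y) (b≤a ∷ y≼x) = cong₂ _∷_ (≤-antisym a≤b b≤a) (≼-antisym x≼y y≼x)

≼-∷ʳ⁻ : ∀ {q} {x y : Point q} {a b} → x ∷ʳ a ≼ y ∷ʳ b → x ≼ y × a ≤ b
≼-∷ʳ⁻ {x = []} {[]} (a≤b ∷ []) = [] , a≤b
≼-∷ʳ⁻ {x = _ ∷ x} {_ ∷ y} (c≤d ∷ rest) = let x≼y , a≤b = ≼-∷ʳ⁻ {x = x} {y} rest in c≤d ∷ x≼y , a≤b

≼-∷ʳ⁺ : ∀ {q} {x y : Point q} {a b} → x ≼ y → a ≤ b → x ∷ʳ a ≼ y ∷ʳ b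
≼-∷ʳ⁺ [] a≤b = a≤b ∷ []
≼-∷ʳ⁺ (c≤d ∷ x≼y) a≤b = c≤d ∷ ≼-∷ʳ⁺ x≼y a≤b

∷ʳ²-injective : ∀ {q} (x y : Point q) {a b c d} → x ∷ʳ a ∷ʳ b ≡ y ∷ʳ c ∷ʳ d → x ≡ y × a ≡ c × b ≡ d
∷ʳ²-injective x y eq =
  let xa≡yc , b≡d = ∷ʳ-injective (x ∷ʳ _) (y ∷ʳ _) eq
      x≡y , a≡c = ∷ʳ-injective x y xa≡yc
  in x≡y , a≡c , b≡d

≼-∷ʳ²⁻ : ∀ {q} {x y : Point q} {a b c d} → x ∷ʳ a ∷ʳ b ≼ y ∷ʳ c ∷ʳ d → x ≼ y × a ≤ c × b ≤ d
≼-∷ʳ²⁻ le = let xa≼yc , b≤d = ≼-∷ʳ⁻ le ; x≼y , a≤c = ≼-∷ʳ⁻ xa≼yc in x≼y , a≤c , b≤d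

≺-∷ʳ : ∀ {q} {x y : Point q} {a b} → x ≺ y → a ≤ b → (x ∷ʳ a) ≺ (y ∷ʳ b)
≺-∷ʳ {x = x} {y} (x≼y , x≢y) a≤b = ≼-∷ʳ⁺ x≼y a≤b , x≢y ∘ proj₁ ∘ ∷ʳ-injective x y

≺-∷ʳ-last : ∀ {q} {x y : Point q} {a b} → x ≼ y → a < b → (x ∷ʳ a) ≺ (y ∷ʳ b)
≺-∷ʳ-last {x = x} {y} x≼y a<b = ≼-∷ʳ⁺ x≼y (<⇒≤ a<b) , <⇒≢ a<b ∘ proj₂ ∘ ∷ʳ-injective x y

≺⇒⋡ : ∀ {q} {x y : Point q} → x ≺ y → ¬ y ≼ x
≺⇒⋡ (x≼y , x≢y) y≼x = x≢y (≼-antisym x≼y y≼x)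

pmax-∷ʳ : ∀ {q} (x y : Point q) a b → pmax (x ∷ʳ a) (y ∷ʳ b) ≡ pmax x y ∷ʳ (a ⊔ b)
pmax-∷ʳ [] [] a b = refl
pmax-∷ʳ (c ∷ x) (d ∷ y) a b = cong ((c ⊔ d) ∷_) (pmax-∷ʳ x y a b)

pmax-∷ʳ² : ∀ {q} (x y : Point q) a b c d → pmax (x ∷ʳ a ∷ʳ b) (y ∷ʳ c ∷ʳ d) ≡ pmax x y ∷ʳ (a ⊔ c) ∷ʳ (b ⊔ d)
pmax-∷ʳ² x y a b c d = trans (pmax-∷ʳ (x ∷ʳ a) (y ∷ʳ c) b d) (cong (_∷ʳ (b ⊔ d)) (pmax-∷ʳ x y a c))

pmax-≼ : ∀ {q} {x y : Point q} → x ≼ y → pmax x y ≡ y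
pmax-≼ [] = refl
pmax-≼ (a≤b ∷ x≼y) = cong₂ _∷_ (m≤n⇒m⊔n≡n a≤b) (pmax-≼ x≼y)

ones : ∀ q → Point q
ones q = replicate q 1

ones-∷ʳ : ∀ q → ones q ∷ʳ 1 ≡ ones (suc q)
ones-∷ʳ zero = refl
ones-∷ʳ (suc q) = cong (1 ∷_) (ones-∷ʳ q)

ones-∷ʳ² : ∀ q → ones q ∷ʳ 1 ∷ʳ 1 ≡ ones (2 + q)
ones-∷ʳ² q = trans (cong (_∷ʳ 1) (ones-∷ʳ q)) (ones-∷ʳ (suc q))

-- Antichains and nondominated points

Incomparable : ∀ {q} → Point q → Point q → Set
Incomparable x y = ¬ x ≼ y × ¬ y ≼ x

Antichain : ∀ {q} → List (Point q) → Set
Antichain = AllPairs Incomparable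

incomparable-∷ʳ : ∀ {q} {x y : Point q} c → Incomparable x y → Incomparable (x ∷ʳ c) (y ∷ʳ c)
incomparable-∷ʳ c (x⋠y , y⋠x) = (λ le → x⋠y (proj₁ (≼-∷ʳ⁻ le))) , (λ le → y⋠x (proj₁ (≼-∷ʳ⁻ le)))

antichain-∷ʳ : ∀ {q} {S : List (Point q)} c → Antichain S → Antichain (map (_∷ʳ c) S)
antichain-∷ʳ c = AllPairs.map⁺ ∘ AllPairs.map (incomparable-∷ʳ c)

antichain⇒unique : ∀ {q} {S : List (Point q)} → Antichain S → Unique S
antichain⇒unique = AllPairs.map λ { (x⋠y , _) refl → x⋠y (≼-refl _) }

antichain⇒stable : ∀ {q} {S : List (Point q)} → Antichain S → Stable S
antichain⇒stable (_ ∷ _) (here refl) (here refl) (_ , z≢z) = z≢z refl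
antichain⇒stable (inc ∷ _) (here refl) (there z'∈) (z≼z' , _) = proj₁ (All.lookup inc z'∈) z≼z'
antichain⇒stable (inc ∷ _) (there z∈) (here refl) (z≼z' , _) = proj₂ (All.lookup inc z∈) z≼z'
antichain⇒stable (_ ∷ ac) (there z∈) (there z'∈) = antichain⇒stable ac z∈ z'∈

Undominated : ∀ {q} → List (Point q) → Point q → Set
Undominated M z = ¬ Any (_≺ z) M

undominated? : ∀ {q} (M : List (Point q)) (z : Point q) → Dec (Undominated M z)
undominated? M z = ¬? (any? (_≺? z) M)

undominated : ∀ {q} {M : List (Point q)} {z} → (∀ {w} → w ∈ M → ¬ w ≺ z) → Undominated M z
undominated none (here w≺z) = none (here refl) w≺z
undominated none (there w≺z) = undominated (none ∘ there) w≺z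

dominated : ∀ {q} {M : List (Point q)} {z w} → w ∈ M → w ≺ z → ¬ Undominated M z
dominated (here refl) w≺z undom = undom (here w≺z)
dominated (there w∈) w≺z undom = dominated w∈ w≺z (undom ∘ there)

deduplicate-unique : ∀ {q} {M : List (Point q)} → Unique M → deduplicate (≡-dec _≟_) M ≡ M
deduplicate-unique [] = refl
deduplicate-unique {M = x ∷ _} (x∉ ∷ u) rewrite deduplicate-unique u =
  cong (x ∷_) (filter-all (λ y → ¬? (≡-dec _≟_ x y)) x∉)

nd-unique : ∀ {q} {M : List (Point q)} → Unique M → nd M ≡ filter (undominated? M) M
nd-unique {M = M} u = cong₂ (λ X Y → filter (undominated? X) Y) M′≡M M′≡M
  where M′≡M = deduplicate-unique u

nd-antichain : ∀ {q} {M : List (Point q)} → Antichain M → nd M ≡ M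
nd-antichain {M = M} ac = trans (nd-unique (antichain⇒unique ac))
  (filter-all (undominated? M) (All.tabulate λ z∈ → undominated λ w∈ → antichain⇒stable ac w∈ z∈))

-- Sweeps of the WFG algorithm

SortedByLast : ∀ {q} → List (Point (suc q)) → Set
SortedByLast = AllPairs (λ x y → last x ≤ last y)

sortLast-sorted : ∀ {q} {xs : List (Point (suc q))} → SortedByLast xs → sortLast xs ≡ xs
sortLast-sorted [] = refl
sortLast-sorted {xs = z ∷ zs} (z≤zs ∷ sorted) rewrite sortLast-sorted sorted = insert-least z≤zs
  where
  insert-least : ∀ {ws} → All (λ w → last z ≤ last w) ws → insertLast z ws ≡ z ∷ ws
  insert-least [] = refl
  insert-least {w ∷ _} (z≤w ∷ _) with last z ≤ᵇ last w | ≤⇒≤ᵇ z≤w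
  ... | true | _ = refl

all-last-∷ʳ : ∀ {q} {P : ℕ → Set} {c} (S : List (Point q)) → P c → All (P ∘ last) (map (_∷ʳ c) S)
all-last-∷ʳ {P = P} {c} S pc = All.map⁺ (All.tabulate λ {s} _ → subst P (sym (last-∷ʳ c s)) pc)

sorted-∷ʳ : ∀ {q} c (S : List (Point q)) → SortedByLast (map (_∷ʳ c) S)
sorted-∷ʳ c [] = []
sorted-∷ʳ c (s ∷ S) = all-last-∷ʳ {P = last (s ∷ʳ c) ≤_} S (≤-reflexive (last-∷ʳ c s)) ∷ sorted-∷ʳ c S

map-init-∷ʳ : ∀ {q} c (S : List (Point q)) → map init (map (_∷ʳ c) S) ≡ S
map-init-∷ʳ c [] = refl
map-init-∷ʳ c (s ∷ S) = cong₂ _∷_ (init-∷ʳ c s) (map-init-∷ʳ c S)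

stepTime : ∀ d → List (Point (3 + d)) → Point (3 + d) → ℕ
stepTime d N z = wfgTime d (map init (nd (map (pmax z) N)))

sweep-skip : ∀ d N xs ys → sweep d (N ++ xs) ys ≤ sweep d N (xs ++ ys)
sweep-skip d N [] ys rewrite ++-identityʳ N = ≤-refl
sweep-skip d N (x ∷ xs) ys = begin
  sweep d (N ++ x ∷ xs) ys          ≡⟨ cong (λ M → sweep d M ys) (sym (++-assoc N [ x ] xs)) ⟩
  sweep d ((N ++ [ x ]) ++ xs) ys   ≤⟨ sweep-skip d (N ++ [ x ]) xs ys ⟩
  sweep d (N ++ [ x ]) (xs ++ ys)   ≤⟨ m≤n+m _ (1 + stepTime d N x) ⟩
  sweep d N (x ∷ xs ++ ys)          ∎
  where open ≤-Reasoning

stepTime≤sweep : ∀ d N z zs → stepTime d N z ≤ sweep d N (z ∷ zs)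
stepTime≤sweep d N z zs = ≤-trans (n≤1+n _) (m≤m+n _ (sweep d (N ++ [ z ]) zs))

wfgTime≡sweep : ∀ d {L} → SortedByLast L → wfgTime (suc d) L ≡ sweep d [] L
wfgTime≡sweep d sorted = cong (sweep d []) (sortLast-sorted sorted)

-- Capping a set by one dimension

capped : ∀ {q} → ℕ → ℕ → List (Point q) → List (Point (suc q))
capped c c′ S = map (_∷ʳ c) S ++ [ ones _ ∷ʳ c′ ]

sorted-capped : ∀ {q} {c c′} (S : List (Point q)) → c ≤ c′ → SortedByLast (capped c c′ S)
sorted-capped {q} {c} {c′} S c≤c′ = AllPairs.++⁺ (sorted-∷ʳ c S) ([] ∷ [])
  (All.map (λ x≤c → ≤-trans x≤c (≤-reflexive (sym (last-∷ʳ c′ (ones q)))) ∷ []) (all-last-∷ʳ S c≤c′))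

pmax-cap : ∀ {q} {c c′} → c ≤ c′ → (S : List (Point q)) → All (ones q ≼_) S →
           map (pmax (ones q ∷ʳ c′)) (map (_∷ʳ c) S) ≡ map (_∷ʳ c′) S
pmax-cap c≤c′ [] [] = refl
pmax-cap {q} {c} {c′} c≤c′ (s ∷ S) (1≼s ∷ 1≼S) = cong₂ _∷_
  (trans (pmax-∷ʳ (ones q) s c′ c) (cong₂ _∷ʳ_ (pmax-≼ 1≼s) (m≥n⇒m⊔n≡m c≤c′)))
  (pmax-cap c≤c′ S 1≼S)

wfgTime-capped : ∀ d {S : List (Point (2 + d))} {c c′} → Antichain S → All (ones _ ≼_) S → c ≤ c′ →
                 wfgTime d S ≤ wfgTime (suc d) (capped c c′ S)
wfgTime-capped d {S} {c} {c′} ac 1≼S c≤c′ = begin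
  wfgTime d S                                       ≡⟨ cong (wfgTime d) (sym (map-init-∷ʳ c′ S)) ⟩
  wfgTime d (map init (map (_∷ʳ c′) S))             ≡⟨ cong (wfgTime d ∘ map init) (sym (nd-antichain (antichain-∷ʳ c′ ac))) ⟩
  wfgTime d (map init (nd (map (_∷ʳ c′) S)))        ≡⟨ cong (wfgTime d ∘ map init ∘ nd) (sym (pmax-cap c≤c′ S 1≼S)) ⟩
  stepTime d (map (_∷ʳ c) S) (ones _ ∷ʳ c′)         ≤⟨ stepTime≤sweep d (map (_∷ʳ c) S) (ones _ ∷ʳ c′) [] ⟩
  sweep d (map (_∷ʳ c) S) [ ones _ ∷ʳ c′ ]          ≤⟨ sweep-skip d [] (map (_∷ʳ c) S) _ ⟩
  sweep d [] (capped c c′ S)                        ≡⟨ wfgTime≡sweep d (sorted-capped S c≤c′) ⟨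
  wfgTime (suc d) (capped c c′ S)                   ∎
  where open ≤-Reasoning

antichain-capped : ∀ {q} {S : List (Point q)} {c c′} → c < c′ → Antichain S → All (ones q ≺_) S →
                   Antichain (capped c c′ S)
antichain-capped {q} {S} {c} {c′} c<c′ ac 1≺S = AllPairs.++⁺ (antichain-∷ʳ c ac) ([] ∷ [])
  (All.map⁺ (All.map (λ 1≺s → below-cap 1≺s ∷ []) 1≺S))
  where
  below-cap : ∀ {s} → ones q ≺ s → Incomparable (s ∷ʳ c) (ones q ∷ʳ c′)
  below-cap 1≺s = (λ le → ≺⇒⋡ 1≺s (proj₁ (≼-∷ʳ⁻ le))) , (λ le → <⇒≱ c<c′ (proj₂ (≼-∷ʳ⁻ le)))

length-capped : ∀ {q} c c′ (S : List (Point q)) → length (capped c c′ S) ≡ suc (length S)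
length-capped c c′ S = trans (length-++ (map (_∷ʳ c) S)) (trans (cong (_+ 1) (length-map _ S)) (+-comm _ 1))

-- Ladders and lifts

countdown : ℕ → ℕ → List ℕ
countdown a k = map (_+ a) (downFrom k)

countdown-≥ : ∀ {a k β} → β ∈ countdown a k → a ≤ β
countdown-≥ {a} β∈ with i , _ , refl ← ∈-map⁻ (_+ a) β∈ = m≤n+m a i

countdown-unique : ∀ a k → Unique (countdown a k)
countdown-unique a k = Unique.map⁺ (+-cancelʳ-≡ _ _ _) (Unique.downFrom⁺ k)

layer : ∀ {q} → ℕ → ℕ → List (Point q) → List (Point (2 + q))
layer α l S = map (λ s → s ∷ʳ α ∷ʳ l) S

layer-∘ : ∀ {q} α l (S : List (Point q)) → layer α l S ≡ map (_∷ʳ l) (map (_∷ʳ α) S)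
layer-∘ α l S = map-∘ S

map-init-layer : ∀ {q} α l (S : List (Point q)) → map init (layer α l S) ≡ map (_∷ʳ α) S
map-init-layer α l S = trans (cong (map init) (layer-∘ α l S)) (map-init-∷ʳ l (map (_∷ʳ α) S))

column : ∀ q → ℕ → List ℕ → List (Point (2 + q))
column q l βs = map (λ β → ones q ∷ʳ β ∷ʳ l) βs

pmax-layer : ∀ {q} {a b α l} → a ≤ α → b ≤ l → (S : List (Point q)) → All (ones q ≼_) S →
             map (pmax (ones q ∷ʳ α ∷ʳ l)) (layer a b S) ≡ layer α l S
pmax-layer a≤α b≤l [] [] = refl
pmax-layer {q} {a} {b} {α} {l} a≤α b≤l (s ∷ S) (1≼s ∷ 1≼S) = cong₂ _∷_
  (trans (pmax-∷ʳ² (ones q) s α l a b)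
         (cong₂ (λ x (m , n) → x ∷ʳ m ∷ʳ n) (pmax-≼ 1≼s) (cong₂ _,_ (m≥n⇒m⊔n≡m a≤α) (m≥n⇒m⊔n≡m b≤l))))
  (pmax-layer a≤α b≤l S 1≼S)

nd-layer-column : ∀ {q} {S : List (Point q)} α l k → Antichain S → All (ones q ≺_) S →
  nd (layer α l S ++ column q l (countdown (suc α) (suc k))) ≡ layer α l S ++ [ ones q ∷ʳ suc α ∷ʳ l ]
nd-layer-column {q} {S} α l k ac 1≺S = begin
  nd M                                                 ≡⟨ nd-unique unique ⟩
  filter (undominated? M) (L ++ C (suc k))             ≡⟨ filter-++ (undominated? M) L (C (suc k)) ⟩
  filter (undominated? M) L ++ filter (undominated? M) (C (suc k))
                                                       ≡⟨ cong₂ _++_ (filter-all (undominated? M) (All.map⁺ (All.tabulate keep-layer)))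
                                                                     (keep-lowest k) ⟩
  L ++ [ W ]                                           ∎
  where
  open ≡-Reasoning
  L = layer α l S
  C = λ j → column q l (countdown (suc α) j)
  M = L ++ C (suc k)
  W = ones q ∷ʳ suc α ∷ʳ l

  from-column : ∀ {w} → w ∈ C (suc k) → ∃ λ β → suc α ≤ β × w ≡ ones q ∷ʳ β ∷ʳ l
  from-column w∈ with β , β∈ , refl ← ∈-map⁻ _ w∈ = β , countdown-≥ β∈ , refl

  unique : Unique M
  unique = Unique.++⁺
    (Unique.map⁺ (proj₁ ∘ ∷ʳ²-injective _ _) (antichain⇒unique ac))
    (Unique.map⁺ (proj₁ ∘ proj₂ ∘ ∷ʳ²-injective _ _) (countdown-unique (suc α) (suc k)))
    λ (v∈L , v∈C) → case-disjoint v∈L v∈C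
    where
    case-disjoint : ∀ {v} → v ∈ L → v ∈ C (suc k) → ⊥
    case-disjoint v∈L v∈C with s , s∈ , refl ← ∈-map⁻ _ v∈L | _ , _ , eq ← from-column v∈C =
      ≺⇒⋡ (All.lookup 1≺S s∈) (subst (s ≼_) (proj₁ (∷ʳ²-injective _ _ eq)) (≼-refl s))

  keep-layer : ∀ {s} → s ∈ S → Undominated M (s ∷ʳ α ∷ʳ l)
  keep-layer {s} s∈ = undominated not-below
    where
    not-below : ∀ {w} → w ∈ M → ¬ w ≺ (s ∷ʳ α ∷ʳ l)
    not-below w∈ (w≼ , w≢) with ∈-++⁻ L w∈
    ... | inj₁ w∈L with s′ , s′∈ , refl ← ∈-map⁻ _ w∈L =
      antichain⇒stable ac s′∈ s∈ (proj₁ (≼-∷ʳ²⁻ w≼) , w≢ ∘ cong (λ x → x ∷ʳ α ∷ʳ l))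
    ... | inj₂ w∈C with β , α<β , refl ← from-column w∈C = <⇒≱ α<β (proj₁ (proj₂ (≼-∷ʳ²⁻ w≼)))

  keep-W : Undominated M W
  keep-W = undominated not-below
    where
    not-below : ∀ {w} → w ∈ M → ¬ w ≺ W
    not-below w∈ (w≼ , w≢) with ∈-++⁻ L w∈
    ... | inj₁ w∈L with s , s∈ , refl ← ∈-map⁻ _ w∈L = ≺⇒⋡ (All.lookup 1≺S s∈) (proj₁ (≼-∷ʳ²⁻ w≼))
    ... | inj₂ w∈C with β , α<β , refl ← from-column w∈C =
      w≢ (cong (λ b → ones q ∷ʳ b ∷ʳ l) (≤-antisym (proj₁ (proj₂ (≼-∷ʳ²⁻ w≼))) α<β))

  W∈M : W ∈ M
  W∈M = ∈-++⁺ʳ L (∈-map⁺ _ (∈-map⁺ (_+ suc α) (∈-downFrom⁺ (s≤s z≤n))))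

  W≺ : ∀ {β} → suc α < β → W ≺ (ones q ∷ʳ β ∷ʳ l)
  W≺ α<β = ≺-∷ʳ (≺-∷ʳ-last (≼-refl (ones q)) α<β) ≤-refl

  keep-lowest : ∀ j → filter (undominated? M) (C (suc j)) ≡ [ W ]
  keep-lowest zero = filter-accept (undominated? M) keep-W
  keep-lowest (suc j) = trans (filter-reject (undominated? M) (dominated W∈M (W≺ (s≤s (m≤n+m (suc α) j)))))
                              (keep-lowest j)

ladder : ∀ q → ℕ → ℕ → ℕ → List (Point (2 + q))
ladder q a l zero = []
ladder q a l (suc k) = (ones q ∷ʳ (k + a) ∷ʳ l) ∷ ladder q a (suc l) k

data Rung (q a b l : ℕ) : Point (2 + q) → Set where
  rung : ∀ {β μ} → a ≤ β → β < b → l ≤ μ → Rung q a b l (ones q ∷ʳ β ∷ʳ μ)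

ladder-rungs : ∀ q a l k → All (Rung q a (k + a) l) (ladder q a l k)
ladder-rungs q a l zero = []
ladder-rungs q a l (suc k) = rung (m≤n+m a k) ≤-refl ≤-refl ∷ All.map lower (ladder-rungs q a (suc l) k)
  where
  lower : ∀ {w} → Rung q a (k + a) (suc l) w → Rung q a (suc k + a) l w
  lower (rung a≤β β<b l<μ) = rung a≤β (m<n⇒m<1+n β<b) (<⇒≤ l<μ)

antichain-ladder : ∀ q a l k → Antichain (ladder q a l k)
antichain-ladder q a l zero = []
antichain-ladder q a l (suc k) = All.map incomparable (ladder-rungs q a (suc l) k) ∷ antichain-ladder q a (suc l) k
  where
  incomparable : ∀ {w} → Rung q a (k + a) (suc l) w → Incomparable (ones q ∷ʳ (k + a) ∷ʳ l) w
  incomparable (rung _ β<b l<μ) = (λ le → <⇒≱ β<b (proj₁ (proj₂ (≼-∷ʳ²⁻ le))))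
                                , (λ le → <⇒≱ l<μ (proj₂ (proj₂ (≼-∷ʳ²⁻ le))))

sorted-ladder : ∀ q a l k → SortedByLast (ladder q a l k)
sorted-ladder q a l zero = []
sorted-ladder q a l (suc k) = All.map below (ladder-rungs q a (suc l) k) ∷ sorted-ladder q a (suc l) k
  where
  below : ∀ {w} → Rung q a (k + a) (suc l) w → last (ones q ∷ʳ (k + a) ∷ʳ l) ≤ last w
  below (rung {β} {μ} _ _ l<μ) = subst₂ _≤_ (sym (last-∷ʳ l (ones q ∷ʳ (k + a)))) (sym (last-∷ʳ μ (ones q ∷ʳ β))) (<⇒≤ l<μ)

ones≺rung : ∀ {q a b l w} → 2 ≤ a → 1 ≤ l → Rung q a b l w → ones (2 + q) ≺ w
ones≺rung {q} 2≤a 1≤l (rung {β} {μ} a≤β _ l≤μ) =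
  subst (_≺ (ones q ∷ʳ β ∷ʳ μ)) (ones-∷ʳ² q) (≺-∷ʳ (≺-∷ʳ-last (≼-refl (ones q)) (≤-trans 2≤a a≤β)) (≤-trans 1≤l l≤μ))

length-ladder : ∀ q a l k → length (ladder q a l k) ≡ k
length-ladder q a l zero = refl
length-ladder q a l (suc k) = cong suc (length-ladder q a (suc l) k)

ladder-snoc : ∀ q b l k → ladder q (suc b) l k ++ [ ones q ∷ʳ b ∷ʳ (k + l) ] ≡ ladder q b l (suc k)
ladder-snoc q b l zero = refl
ladder-snoc q b l (suc k) = cong₂ _∷_
  (cong (λ β → ones q ∷ʳ β ∷ʳ l) (+-suc k b))
  (trans (cong (λ μ → ladder q (suc b) (suc l) k ++ [ ones q ∷ʳ b ∷ʳ μ ]) (sym (+-suc k l)))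
         (ladder-snoc q b (suc l) k))

pmax-ladder : ∀ q {α l} k l₀ β₀ → α ≤ β₀ → k + l₀ ≤ suc l →
              map (pmax (ones q ∷ʳ α ∷ʳ l)) (ladder q β₀ l₀ k) ≡ column q l (countdown β₀ k)
pmax-ladder q zero l₀ β₀ α≤β₀ bound = refl
pmax-ladder q {α} {l} (suc k) l₀ β₀ α≤β₀ bound = cong₂ _∷_
  (trans (pmax-∷ʳ² (ones q) (ones q) α l (k + β₀) l₀)
         (cong₂ (λ x (m , n) → x ∷ʳ m ∷ʳ n) (pmax-≼ (≼-refl (ones q)))
                (cong₂ _,_ (m≤n⇒m⊔n≡n (≤-trans α≤β₀ (m≤n+m β₀ k))) (m≥n⇒m⊔n≡m l₀≤l))))
  (pmax-ladder q k (suc l₀) β₀ α≤β₀ (≤-trans (≤-reflexive (+-suc k l₀)) bound))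
  where
  l₀≤l : l₀ ≤ l
  l₀≤l = ≤-pred (≤-trans (s≤s (m≤n+m l₀ k)) bound)

project-rung : ∀ {q} {S : List (Point q)} α l₀ k → 1 ≤ α → Antichain S → All (ones q ≺_) S →
  map init (nd (map (pmax (ones q ∷ʳ α ∷ʳ (suc k + l₀))) (layer 1 1 S ++ ladder q (suc α) l₀ (suc k))))
    ≡ capped α (suc α) S
project-rung {q} {S} α l₀ k 1≤α ac 1≺S = begin
  map init (nd (map z (layer 1 1 S ++ ladder q (suc α) l₀ (suc k))))
    ≡⟨ cong (map init ∘ nd) (map-++ z (layer 1 1 S) _) ⟩
  map init (nd (map z (layer 1 1 S) ++ map z (ladder q (suc α) l₀ (suc k))))
    ≡⟨ cong₂ (λ X Y → map init (nd (X ++ Y)))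
             (pmax-layer 1≤α (s≤s z≤n) S (All.map proj₁ 1≺S))
             (pmax-ladder q (suc k) l₀ (suc α) (n≤1+n α) (n≤1+n _)) ⟩
  map init (nd (layer α l S ++ column q l (countdown (suc α) (suc k))))
    ≡⟨ cong (map init) (nd-layer-column α l k ac 1≺S) ⟩
  map init (layer α l S ++ [ ones q ∷ʳ suc α ∷ʳ l ])
    ≡⟨ map-++ init (layer α l S) _ ⟩
  map init (layer α l S) ++ [ init (ones q ∷ʳ suc α ∷ʳ l) ]
    ≡⟨ cong₂ (λ X y → X ++ [ y ]) (map-init-layer α l S) (init-∷ʳ l (ones q ∷ʳ suc α)) ⟩
  capped α (suc α) S ∎
  where
  open ≡-Reasoning
  l = suc k + l₀
  z = pmax (ones q ∷ʳ α ∷ʳ l)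

lift : ∀ {q} → ℕ → List (Point q) → List (Point (2 + q))
lift t S = layer 1 1 S ++ ladder _ 2 2 (suc t)

floor-incomparable-rung : ∀ {q a b} {s : Point q} {w} → ones q ≺ s → Rung q a b 2 w → Incomparable (s ∷ʳ 1 ∷ʳ 1) w
floor-incomparable-rung 1≺s (rung _ _ 2≤μ) = (λ le → ≺⇒⋡ 1≺s (proj₁ (≼-∷ʳ²⁻ le)))
                                           , (λ le → <⇒≱ 2≤μ (proj₂ (proj₂ (≼-∷ʳ²⁻ le))))

floor-below-rung : ∀ {q a b} (s : Point q) {w} → Rung q a b 2 w → last (s ∷ʳ 1 ∷ʳ 1) ≤ last w
floor-below-rung {q} s (rung {β} {μ} _ _ 2≤μ) =
  subst₂ _≤_ (sym (last-∷ʳ 1 (s ∷ʳ 1))) (sym (last-∷ʳ μ (ones q ∷ʳ β))) (≤-trans (n≤1+n 1) 2≤μ)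

antichain-lift : ∀ {q} {S : List (Point q)} t → Antichain S → All (ones q ≺_) S → Antichain (lift t S)
antichain-lift {q} {S} t ac 1≺S = AllPairs.++⁺
  (subst Antichain (sym (layer-∘ 1 1 S)) (antichain-∷ʳ 1 (antichain-∷ʳ 1 ac)))
  (antichain-ladder q 2 2 (suc t))
  (All.map⁺ (All.map (λ 1≺s → All.map (floor-incomparable-rung 1≺s) (ladder-rungs q 2 2 (suc t))) 1≺S))

ones≺lift : ∀ {q} {S : List (Point q)} t → All (ones q ≺_) S → All (ones (2 + q) ≺_) (lift t S)
ones≺lift {q} t 1≺S = All.++⁺
  (All.map⁺ (All.map (λ {s} 1≺s → subst (_≺ (s ∷ʳ 1 ∷ʳ 1)) (ones-∷ʳ² q) (≺-∷ʳ (≺-∷ʳ 1≺s ≤-refl) ≤-refl)) 1≺S))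
  (All.map (ones≺rung ≤-refl (s≤s z≤n)) (ladder-rungs q 2 2 (suc t)))

sorted-lift : ∀ {q} t (S : List (Point q)) → SortedByLast (lift t S)
sorted-lift {q} t S = AllPairs.++⁺
  (subst SortedByLast (sym (layer-∘ 1 1 S)) (sorted-∷ʳ 1 (map (_∷ʳ 1) S)))
  (sorted-ladder q 2 2 (suc t))
  (All.map⁺ (All.tabulate λ {s} _ → All.map (floor-below-rung s) (ladder-rungs q 2 2 (suc t))))

length-lift : ∀ {q} t (S : List (Point q)) → length (lift t S) ≡ length S + suc t
length-lift {q} t S = trans (length-++ (layer 1 1 S)) (cong₂ _+_ (length-map _ S) (length-ladder q 2 2 (suc t)))

module _ {d} {S : List (Point (2 + d))} (ac : Antichain S) (1≺S : All (ones _ ≺_) S) where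

  rung-cost : ∀ α l₀ k → 1 ≤ α →
    wfgTime d S ≤ stepTime (suc d) (layer 1 1 S ++ ladder _ (suc α) l₀ (suc k)) (ones _ ∷ʳ α ∷ʳ (suc k + l₀))
  rung-cost α l₀ k 1≤α = begin
    wfgTime d S                          ≤⟨ wfgTime-capped d ac (All.map proj₁ 1≺S) (n≤1+n α) ⟩
    wfgTime (suc d) (capped α (suc α) S) ≡⟨ cong (wfgTime (suc d)) (project-rung α l₀ k 1≤α ac 1≺S) ⟨
    stepTime (suc d) (layer 1 1 S ++ ladder _ (suc α) l₀ (suc k)) (ones _ ∷ʳ α ∷ʳ (suc k + l₀)) ∎
    where open ≤-Reasoning

  sweep-ladder : ∀ t a l₀ k → 1 ≤ a →
    t * wfgTime d S ≤ sweep (suc d) (layer 1 1 S ++ ladder _ (t + a) l₀ (suc k)) (ladder _ a (suc k + l₀) t)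
  sweep-ladder zero a l₀ k 1≤a = z≤n
  sweep-ladder (suc t) a l₀ k 1≤a =
    +-mono-≤ (≤-trans (rung-cost (t + a) l₀ k (≤-trans 1≤a (m≤n+m a t))) (n≤1+n _))
             (≤-trans (sweep-ladder t a l₀ (suc k) 1≤a) (≤-reflexive (cong (λ N → sweep (suc d) N rest) processed)))
    where
    rest = ladder _ a (suc (suc k + l₀)) t
    processed : layer 1 1 S ++ ladder _ (t + a) l₀ (suc (suc k))
              ≡ (layer 1 1 S ++ ladder _ (suc t + a) l₀ (suc k)) ++ [ ones _ ∷ʳ (t + a) ∷ʳ (suc k + l₀) ]
    processed = trans (cong (layer 1 1 S ++_) (sym (ladder-snoc _ (t + a) l₀ (suc k)))) (sym (++-assoc (layer 1 1 S) _ _))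

  wfgTime-lift : ∀ t → t * wfgTime d S ≤ wfgTime (suc (suc d)) (lift t S)
  wfgTime-lift t = begin
    t * wfgTime d S                                                     ≤⟨ sweep-ladder t 2 2 0 (s≤s z≤n) ⟩
    sweep (suc d) (layer 1 1 S ++ [ bottom ]) (ladder _ 2 3 t)          ≤⟨ sweep-skip (suc d) (layer 1 1 S) [ bottom ] (ladder _ 2 3 t) ⟩
    sweep (suc d) (layer 1 1 S) (ladder _ 2 2 (suc t))                  ≤⟨ sweep-skip (suc d) [] (layer 1 1 S) _ ⟩
    sweep (suc d) [] (lift t S)                                         ≡⟨ wfgTime≡sweep (suc d) (sorted-lift t S) ⟨
    wfgTime (suc (suc d)) (lift t S)                                    ∎
    where
    open ≤-Reasoning
    bottom = ones _ ∷ʳ (t + 2) ∷ʳ 2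

-- Staircases

staircase : ∀ m → ℕ → ℕ → List (Point (2 + m * 2))
staircase zero b t = ladder 0 2 2 b
staircase (suc m) b t = lift t (staircase m b t)

ones≺staircase : ∀ m b t → All (ones _ ≺_) (staircase m b t)
ones≺staircase zero b t = All.map (ones≺rung ≤-refl (s≤s z≤n)) (ladder-rungs 0 2 2 b)
ones≺staircase (suc m) b t = ones≺lift t (ones≺staircase m b t)

antichain-staircase : ∀ m b t → Antichain (staircase m b t)
antichain-staircase zero b t = antichain-ladder 0 2 2 b
antichain-staircase (suc m) b t = antichain-lift t (antichain-staircase m b t) (ones≺staircase m b t)

length-staircase : ∀ m b t → length (staircase m b t) ≡ b + m * suc t
length-staircase zero b t = trans (length-ladder 0 2 2 b) (sym (+-identityʳ b))
length-staircase (suc m) b t = begin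
  length (lift t (staircase m b t))    ≡⟨ length-lift t (staircase m b t) ⟩
  length (staircase m b t) + suc t     ≡⟨ cong (_+ suc t) (length-staircase m b t) ⟩
  b + m * suc t + suc t                ≡⟨ +-assoc b _ _ ⟩
  b + (m * suc t + suc t)              ≡⟨ cong (b +_) (+-comm _ (suc t)) ⟩
  b + suc m * suc t                    ∎
  where open ≡-Reasoning

wfgTime-staircase : ∀ m b t → t ^ m * (b * (⌊log₂ b ⌋ + 1)) ≤ wfgTime (m * 2) (staircase m b t)
wfgTime-staircase zero b t rewrite length-ladder 0 2 2 b = ≤-reflexive (+-identityʳ _)
wfgTime-staircase (suc m) b t = begin
  t * t ^ m * (b * (⌊log₂ b ⌋ + 1))              ≡⟨ *-assoc t (t ^ m) _ ⟩
  t * (t ^ m * (b * (⌊log₂ b ⌋ + 1)))            ≤⟨ *-monoʳ-≤ t (wfgTime-staircase m b t) ⟩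
  t * wfgTime (m * 2) (staircase m b t)          ≤⟨ wfgTime-lift (antichain-staircase m b t) (ones≺staircase m b t) t ⟩
  wfgTime (suc m * 2) (staircase (suc m) b t)    ∎
  where open ≤-Reasoning

-- Size and logarithm estimates

n≤2^n : ∀ n → n ≤ 2 ^ n
n≤2^n zero = z≤n
n≤2^n (suc n) = +-mono-≤ (m^n>0 2 n) (≤-trans (n≤2^n n) (m≤m+n _ 0))

⌊log₂[2^k*n]⌋≡k+⌊log₂n⌋ : ∀ k n .{{_ : NonZero n}} → ⌊log₂ (2 ^ k * n) ⌋ ≡ k + ⌊log₂ n ⌋
⌊log₂[2^k*n]⌋≡k+⌊log₂n⌋ zero n = cong ⌊log₂_⌋ (+-identityʳ n)
⌊log₂[2^k*n]⌋≡k+⌊log₂n⌋ (suc k) n = begin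
  ⌊log₂ (2 * 2 ^ k * n) ⌋     ≡⟨ cong ⌊log₂_⌋ (*-assoc 2 (2 ^ k) n) ⟩
  ⌊log₂ (2 * (2 ^ k * n)) ⌋   ≡⟨ ⌊log₂[2*b]⌋≡1+⌊log₂b⌋ (2 ^ k * n) {{m*n≢0 (2 ^ k) n {{m^n≢0 2 k}}}} ⟩
  suc ⌊log₂ (2 ^ k * n) ⌋     ≡⟨ cong suc (⌊log₂[2^k*n]⌋≡k+⌊log₂n⌋ k n) ⟩
  suc (k + ⌊log₂ n ⌋)         ∎
  where open ≡-Reasoning

⌊log₂[m*n]⌋≤m*[1+⌊log₂n⌋] : ∀ m n .{{_ : NonZero m}} .{{_ : NonZero n}} → ⌊log₂ (m * n) ⌋ ≤ m * (⌊log₂ n ⌋ + 1)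
⌊log₂[m*n]⌋≤m*[1+⌊log₂n⌋] m n = begin
  ⌊log₂ (m * n) ⌋          ≤⟨ ⌊log₂⌋-mono-≤ (*-monoˡ-≤ n (n≤2^n m)) ⟩
  ⌊log₂ (2 ^ m * n) ⌋      ≡⟨ ⌊log₂[2^k*n]⌋≡k+⌊log₂n⌋ m n ⟩
  m + ⌊log₂ n ⌋            ≤⟨ +-monoʳ-≤ m (m≤n*m ⌊log₂ n ⌋ m) ⟩
  m + m * ⌊log₂ n ⌋        ≡⟨ factor m ⌊log₂ n ⌋ ⟩
  m * (⌊log₂ n ⌋ + 1)      ∎
  where
  open ≤-Reasoning
  factor : ∀ a x → a + a * x ≡ a * (x + 1)
  factor = solve-∀

^-distribʳ-* : ∀ a b j → (a * b) ^ j ≡ a ^ j * b ^ j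
^-distribʳ-* a b zero = refl
^-distribʳ-* a b (suc j) = trans (cong (a * b *_) (^-distribʳ-* a b j)) (interchange a b (a ^ j) (b ^ j))
  where
  interchange : ∀ a b x y → a * b * (x * y) ≡ a * x * (b * y)
  interchange = solve-∀

power-log-bound : ∀ m Q {n t} b .{{_ : NonZero Q}} .{{_ : NonZero b}} {X} → n ≤ Q * t → n ≤ Q * b →
  t ^ m * (b * (⌊log₂ b ⌋ + 1)) ≤ X → n ^ suc m * ⌊log₂ n ⌋ ≤ Q ^ (2 + m) * X
power-log-bound m Q {n} {t} b {X} n≤Qt n≤Qb cost = begin
  n * n ^ m * ⌊log₂ n ⌋                           ≤⟨ *-mono-≤ (*-mono-≤ n≤Qb (^-monoˡ-≤ m n≤Qt)) log-bound ⟩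
  Q * b * (Q * t) ^ m * (Q * L)                   ≡⟨ cong (λ x → Q * b * x * (Q * L)) (^-distribʳ-* Q t m) ⟩
  Q * b * (Q ^ m * t ^ m) * (Q * L)               ≡⟨ regroup Q b (Q ^ m) (t ^ m) L ⟩
  Q ^ (2 + m) * (t ^ m * (b * L))                 ≤⟨ *-monoʳ-≤ (Q ^ (2 + m)) cost ⟩
  Q ^ (2 + m) * X                                 ∎
  where
  open ≤-Reasoning
  L = ⌊log₂ b ⌋ + 1
  log-bound : ⌊log₂ n ⌋ ≤ Q * L
  log-bound = ≤-trans (⌊log₂⌋-mono-≤ n≤Qb) (⌊log₂[m*n]⌋≤m*[1+⌊log₂n⌋] Q b)
  regroup : ∀ Q b A T L → Q * b * (A * T) * (Q * L) ≡ Q * (Q * A) * (T * (b * L))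
  regroup = solve-∀

split-size : ∀ m n → 2 * suc m ≤ n →
  ∃₂ λ t b → suc b + m * suc t ≡ n × n ≤ 3 * suc m * t × n ≤ suc m * suc b
split-size m n 2[1+m]≤n = from-division (n % suc m) (n / suc m) (m≡m%n+[m/n]*n n (suc m)) (m%n<n n (suc m)) 2≤q
  where
  2≤q : 2 ≤ n / suc m
  2≤q = subst (_≤ n / suc m) (m*n/n≡m 2 (suc m)) (/-monoˡ-≤ (suc m) 2[1+m]≤n)

  from-division : ∀ r q → n ≡ r + q * suc m → r < suc m → 2 ≤ q →
    ∃₂ λ t b → suc b + m * suc t ≡ n × n ≤ 3 * suc m * t × n ≤ suc m * suc b
  from-division r (suc (suc t)) refl r<1+m (s≤s (s≤s z≤n)) = suc t , r + suc t , size , n≤3[1+m]t , n≤[1+m]b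
    where
    open ≤-Reasoning
    size : suc (r + suc t) + m * suc (suc t) ≡ r + suc (suc t) * suc m
    size = rearrange r t m
      where
      rearrange : ∀ r t m → suc (r + suc t) + m * suc (suc t) ≡ r + suc (suc t) * suc m
      rearrange = solve-∀
    n≤3[1+m]t : r + suc (suc t) * suc m ≤ 3 * suc m * suc t
    n≤3[1+m]t = begin
      r + suc (suc t) * suc m                      ≤⟨ +-monoˡ-≤ _ (<⇒≤ r<1+m) ⟩
      suc m + suc (suc t) * suc m                  ≤⟨ m≤m+n _ (2 * (suc m * t)) ⟩
      suc m + suc (suc t) * suc m + 2 * (suc m * t) ≡⟨ collect m t ⟩
      3 * suc m * suc t                            ∎
      where
      collect : ∀ m t → suc m + suc (suc t) * suc m + 2 * (suc m * t) ≡ 3 * suc m * suc t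
      collect = solve-∀
    n≤[1+m]b : r + suc (suc t) * suc m ≤ suc m * suc (r + suc t)
    n≤[1+m]b = begin
      r + suc (suc t) * suc m                      ≤⟨ +-monoˡ-≤ _ (m≤n*m r (suc m)) ⟩
      suc m * r + suc (suc t) * suc m              ≡⟨ collect m r t ⟩
      suc m * suc (r + suc t)                      ∎
      where
      collect : ∀ m r t → suc m * r + suc (suc t) * suc m ≡ suc m * suc (r + suc t)
      collect = solve-∀

1+n≤2*n : ∀ {n} → 1 ≤ n → suc n ≤ 2 * n
1+n≤2*n {suc n} (s≤s z≤n) = s≤s (≤-trans (s≤s (m≤m+n n 0)) (m≤n+m _ n))

≤-double : ∀ {n N} K x → n ≤ 2 * N → N ≤ K * x → n ≤ 2 * K * x
≤-double K x n≤2N N≤Kx = ≤-trans n≤2N (≤-trans (*-monoʳ-≤ 2 N≤Kx) (≤-reflexive (sym (*-assoc 2 K x))))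

even-or-odd : ∀ p → p ≡ p / 2 * 2 ⊎ p ≡ suc (p / 2 * 2)
even-or-odd p with p % 2 | m≡m%n+[m/n]*n p 2 | m%n<n p 2
... | 0 | p≡ | _ = inj₁ p≡
... | 1 | p≡ | _ = inj₂ p≡
... | suc (suc _) | _ | s≤s (s≤s ())

HardInstance : ℕ → ℕ → ℕ → ℕ → Set
HardInstance p k c n =
  Σ (List (Point p)) λ S → length S ≡ n × Unique S × Stable S × n ^ k * ⌊log₂ n ⌋ ≤ suc c * WFGtime p S

WFGLowerBound : ℕ → ℕ → Set
WFGLowerBound p k = ∃ λ c → ∃ λ n₀ → ∀ n → n₀ ≤ n → HardInstance p k c n

hard-instance : ∀ {p} m Q {n t} b .{{_ : NonZero Q}} (S : List (Point p)) → Antichain S → length S ≡ n →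
  n ≤ Q * t → n ≤ Q * suc b → t ^ m * (suc b * (⌊log₂ (suc b) ⌋ + 1)) ≤ WFGtime p S →
  HardInstance p (suc m) (Q ^ (2 + m)) n
hard-instance m Q b S ac |S|≡n n≤Qt n≤Qb cost = S , |S|≡n , antichain⇒unique ac , antichain⇒stable ac ,
  ≤-trans (power-log-bound m Q (suc b) n≤Qt n≤Qb cost) (m≤n+m _ _)

lower-bound-even : ∀ m → WFGLowerBound (2 + m * 2) (suc m)
lower-bound-even m = Q ^ (2 + m) , 2 * suc m , λ n 2[1+m]≤n →
  let t , b , size , n≤3[1+m]t , n≤[1+m]b = split-size m n 2[1+m]≤n
  in hard-instance m Q b (staircase m (suc b) t) (antichain-staircase m (suc b) t)
       (trans (length-staircase m (suc b) t) size)
       n≤3[1+m]t (≤-trans n≤[1+m]b (*-monoˡ-≤ (suc b) (m≤n*m (suc m) 3)))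
       (wfgTime-staircase m (suc b) t)
  where Q = 3 * suc m

lower-bound-odd : ∀ m → WFGLowerBound (3 + m * 2) (suc m)
lower-bound-odd m = Q ^ (2 + m) , suc (2 * suc m) , λ { (suc N) (s≤s 2[1+m]≤N) →
  let t , b , size , N≤3[1+m]t , N≤[1+m]b = split-size m N 2[1+m]≤N
      S = staircase m (suc b) t
      n≤2N = 1+n≤2*n (≤-trans (s≤s z≤n) 2[1+m]≤N)
  in hard-instance m Q b (capped 1 2 S)
       (antichain-capped (n<1+n 1) (antichain-staircase m (suc b) t) (ones≺staircase m (suc b) t))
       (trans (length-capped 1 2 S) (cong suc (trans (length-staircase m (suc b) t) size)))
       (≤-double (3 * suc m) t n≤2N N≤3[1+m]t)
       (≤-double (3 * suc m) (suc b) n≤2N (≤-trans N≤[1+m]b (*-monoˡ-≤ (suc b) (m≤n*m (suc m) 3))))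
       (≤-trans (wfgTime-staircase m (suc b) t)
                (wfgTime-capped (m * 2) (antichain-staircase m (suc b) t) (All.map proj₁ (ones≺staircase m (suc b) t)) (n≤1+n 1))) }
  where Q = 2 * (3 * suc m)

wfg-lower-bound : ∀ p k → p ≡ k * 2 ⊎ p ≡ suc (k * 2) → 1 ≤ k → WFGLowerBound p k
wfg-lower-bound p (suc m) (inj₁ refl) (s≤s z≤n) = lower-bound-even m
wfg-lower-bound p (suc m) (inj₂ refl) (s≤s z≤n) = lower-bound-odd m

proposition3 : ∀ (p : ℕ) → 4 ≤ p →
    ∃ λ (c : ℕ) → ∃ λ (n₀ : ℕ) → ∀ (n : ℕ) → n₀ ≤ n →
      Σ (List (Point p)) λ S →
        length S ≡ n × Unique S × Stable S ×
        (n ^ (p / 2)) * ⌊log₂ n ⌋ ≤ suc c * WFGtime p S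
proposition3 p 4≤p = wfg-lower-bound p (p / 2) (even-or-odd p) (≤-trans (s≤s z≤n) (/-monoˡ-≤ 2 4≤p))
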